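{- Let $A$ be a finite abelian group and $B$ a subgroup of $A$ of index $2$. Suppose that either $A\cong C_4\times C_2^\ell$ for some $\ell\ge 1$ and $B\cong C_2^{\ell+1}$, or $A\cong C_4^2\times C_2^\ell$ for some $\ell\ge 0$ and $B\cong C_4\times C_2^{\ell+1}$. Then there is no inverse-closed subset $S\subseteq A\setminus B$ such that $|\mathrm{Aut}(\mathrm{Cay}(A,S)):A|=2$.
   Context: $C_t$ denotes the cyclic group of order $t$. For a finite group $G$ and $S\subseteq G$, the Cayley digraph $\mathrm{Cay}(G,S)$ has vertex set $G$ and an arc $(g,h)$ if and only if $gh^{ -1}\in S$; when $S=S^{ -1}:=\{s^{ -1}\mid s\in S\}$ it is an (undirected) graph. The group $G$ acts regularly on it by right multiplication and is identified with this subgroup of $\mathrm{Aut}(\mathrm{Cay}(G,S))$. -}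

module Defs where

open import Data.Nat using (ℕ; zero; suc; _*_; _^_; _%_)
open import Data.Nat.DivMod using (m%n<n)
open import Data.Fin using (Fin; toℕ; fromℕ<)
open import Data.Vec using (Vec; zipWith; map; replicate)
open import Data.Product using (Σ; ∃; _×_; _,_; proj₁)
open import Data.Bool using (Bool; true)
open import Relation.Binary.PropositionalEquality using (_≡_)
open import Relation.Nullary using (¬_)
import Data.Nat as ℕ

addC : ∀ {k} → Fin (suc k) → Fin (suc k) → Fin (suc k)
addC {k} i j = fromℕ< (m%n<n (toℕ i ℕ.+ toℕ j) (suc k))

negC : ∀ {k} → Fin (suc k) → Fin (suc k)
negC {k} i = fromℕ< (m%n<n (suc k ℕ.∸ toℕ i) (suc k))

zeroC : ∀ {k} → Fin (suc k)
zeroC = Data.Fin.zero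

G : ℕ → ℕ → Set
G a b = Vec (Fin 4) a × Vec (Fin 2) b

_⊕_ : ∀ {a b} → G a b → G a b → G a b
(x , y) ⊕ (x' , y') = zipWith addC x x' , zipWith addC y y'

⊖_ : ∀ {a b} → G a b → G a b
⊖ (x , y) = map negC x , map negC y

𝟘 : ∀ {a b} → G a b
𝟘 = replicate _ zeroC , replicate _ zeroC

order : ℕ → ℕ → ℕ
order a b = 4 ^ a * 2 ^ b

HasCard : (X : Set) → (X → X → Set) → ℕ → Set
HasCard X _≈_ n =
  Σ (Fin n → X) λ e →
    (∀ i j → e i ≈ e j → i ≡ j) × (∀ x → ∃ λ i → e i ≈ x)

record IsSubgroup {a b} (B : G a b → Set) : Set where
  field
    has-zero : B 𝟘
    closed-⊕ : ∀ x y → B x → B y → B (x ⊕ y)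
    closed-⊖ : ∀ x → B x → B (⊖ x)

Index2 : ∀ {a b} → (G a b → Set) → Set
Index2 {a} {b} B = ∃ λ m → HasCard (Σ (G a b) B) (λ u v → proj₁ u ≡ proj₁ v) m
                            × order a b ≡ 2 * m

IsoTo : ∀ {a b} → (G a b → Set) → ℕ → ℕ → Set
IsoTo {a} {b} B a' b' =
  Σ (G a' b' → G a b) λ φ →
      (∀ x y → φ (x ⊕ y) ≡ φ x ⊕ φ y)
    × (∀ x y → φ x ≡ φ y → x ≡ y)
    × (∀ z → (B z → ∃ λ x → φ x ≡ z) × (∃ (λ x → φ x ≡ z) → B z))

Arc : ∀ {a b} → (G a b → Bool) → G a b → G a b → Set
Arc S g h = S (g ⊕ (⊖ h)) ≡ true

record CayAut {a b} (S : G a b → Bool) : Set where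
  field
    fun : G a b → G a b
    inv : G a b → G a b
    inv-left  : ∀ x → inv (fun x) ≡ x
    inv-right : ∀ x → fun (inv x) ≡ x
    pres : ∀ g h → (Arc S g h → Arc S (fun g) (fun h))
                 × (Arc S (fun g) (fun h) → Arc S g h)

_≈Aut_ : ∀ {a b} {S : G a b → Bool} → CayAut S → CayAut S → Set
σ ≈Aut τ = ∀ x → CayAut.fun σ x ≡ CayAut.fun τ x

InverseClosed : ∀ {a b} → (G a b → Bool) → Set
InverseClosed S = ∀ x → S x ≡ true → S (⊖ x) ≡ true

OutsideOf : ∀ {a b} → (G a b → Bool) → (G a b → Set) → Set
OutsideOf S B = ∀ x → S x ≡ true → ¬ B x

-- |Aut(Cay(A,S)) : A| = 2, i.e. |Aut(Cay(A,S))| = 2 |A|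
-- (A embeds in Aut by regular translations).
AutIndex2 : ∀ {a b} → (G a b → Bool) → Set
AutIndex2 {a} {b} S = HasCard (CayAut S) _≈Aut_ (2 * order a b)

-- The theorem's case hypotheses on (A, B) = (C_4^a × C_2^b, B ≅ C_4^a' × C_2^b').
data Case : ℕ → ℕ → ℕ → ℕ → Set where
  case1 : ∀ ℓ → 1 ℕ.≤ ℓ → Case 1 ℓ 0 (suc ℓ)
  case2 : ∀ ℓ → Case 2 ℓ 1 (suc ℓ)

-- Since B ≅ C₄^a′ × C₂^b′ with a′ + b′ = a + b, B has as many elements of order at most 2 as A,
-- so Ω₁(A) ⊆ B and every element of S ⊆ A ∖ B has order 4.  In the second case B also contains
-- an element z of order 4, so S avoids z + Ω₁(A) as well.  On what is left one finds an
-- involutive automorphism σ ≠ ±1 of A acting on each element as +1 or as −1, so σ maps S onto S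
-- because S = −S.  The maps x ↦ ρ x + c with ρ ∈ {1, −1, σ} and c ∈ A are then 3|A| distinct
-- automorphisms of Cay(A, S), hence |Aut(Cay(A, S)) : A| ≥ 3.
module Submission where

open import Defs
open import Algebra.Bundles using (AbelianGroup)
open import Algebra.Consequences.Propositional using (comm∧idˡ⇒id; comm∧invˡ⇒inv)
open import Algebra.Core using (Op₁; Op₂)
open import Algebra.Definitions using (Associative; Commutative; LeftIdentity; LeftInverse)
open import Algebra.Structures using (IsAbelianGroup)
open import Data.Bool using (Bool; true)
open import Data.Empty using (⊥-elim)
open import Data.Fin using (Fin; toℕ; combine; quotient; remainder)
  renaming (zero to fzero; suc to fsuc)
open import Data.Fin.Patterns using (0F; 1F; 2F; 3F)
open import Data.Fin.Properties
  using (toℕ-fromℕ<; toℕ-injective; toℕ<n; combine-remQuot; remQuot-combine; injective⇒≤; all?; _≟_)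
open import Data.Nat using (ℕ; zero; suc; s≤s; _+_; _∸_; _%_; _^_; _*_; _≤_)
open import Data.Nat.DivMod using (%-distribˡ-+; m%n%n≡m%n; m<n⇒m%n≡m; n%n≡0)
open import Data.Nat.Properties
  using (+-assoc; +-comm; m∸n+n≡m; <⇒≤; ≤⇒≯; ≤-reflexive; ^-distribˡ-+-*; *-cancelʳ-≤; m*n≢0; m^n≢0)
open import Data.Product using (Σ; ∃; _×_; _,_; proj₁; proj₂)
open import Data.Sum using (_⊎_; inj₁; inj₂)
open import Data.Vec using (Vec; []; _∷_; zipWith; map; replicate)
open import Data.Vec.Properties
  using (zipWith-assoc; zipWith-comm; zipWith-identityˡ; zipWith-inverseˡ; ∷-injective; map-∘; map-cong; map-id)
  renaming (≡-dec to ≡-decVec)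
open import Function using (_∘_)
open import Function.Definitions using (Injective)
open import Level using (0ℓ)
open import Relation.Binary.PropositionalEquality
open import Relation.Binary.PropositionalEquality.Algebra using (isMagma)
open import Relation.Binary.Structures using (IsEquivalence)
open import Relation.Nullary using (¬_; Dec)
open import Relation.Nullary.Decidable using (True; toWitness; _⊎-dec_; _×-dec_; ¬?)
open import Relation.Nullary.Negation using (¬¬-map)

isAbelianGroup : {A : Set} {_∙_ : Op₂ A} {ε : A} {_⁻¹ : Op₁ A} →
                 Associative _≡_ _∙_ → Commutative _≡_ _∙_ →
                 LeftIdentity _≡_ ε _∙_ → LeftInverse _≡_ ε _⁻¹ _∙_ →
                 IsAbelianGroup _≡_ _∙_ ε _⁻¹
isAbelianGroup {_∙_ = _∙_} {_⁻¹ = _⁻¹} assoc comm identityˡ inverseˡ = record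
  { isGroup = record
    { isMonoid = record
      { isSemigroup = record { isMagma = isMagma _∙_ ; assoc = assoc }
      ; identity    = comm∧idˡ⇒id comm identityˡ
      }
    ; inverse = comm∧invˡ⇒inv comm inverseˡ
    ; ⁻¹-cong = cong _⁻¹
    }
  ; comm = comm
  }

zipWith-isAbelianGroup : {A : Set} {_∙_ : Op₂ A} {ε : A} {_⁻¹ : Op₁ A} {n : ℕ} →
                         IsAbelianGroup _≡_ _∙_ ε _⁻¹ →
                         IsAbelianGroup _≡_ (zipWith {n = n} _∙_) (replicate n ε) (map _⁻¹)
zipWith-isAbelianGroup G = isAbelianGroup
  (zipWith-assoc assoc) (zipWith-comm comm) (zipWith-identityˡ identityˡ) (zipWith-inverseˡ inverseˡ)
  where open IsAbelianGroup G

module _ {k : ℕ} where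
  private
    t = suc k

  toℕ-addC : (i j : Fin t) → toℕ (addC i j) ≡ (toℕ i + toℕ j) % t
  toℕ-addC i j = toℕ-fromℕ< _

  toℕ-negC : (i : Fin t) → toℕ (negC i) ≡ (t ∸ toℕ i) % t
  toℕ-negC i = toℕ-fromℕ< _

  [m%t+n]%t≡[m+n]%t : ∀ m n → (m % t + n) % t ≡ (m + n) % t
  [m%t+n]%t≡[m+n]%t m n = begin
    (m % t + n) % t          ≡⟨ %-distribˡ-+ (m % t) n t ⟩
    (m % t % t + n % t) % t  ≡⟨ cong (λ u → (u + n % t) % t) (m%n%n≡m%n m t) ⟩
    (m % t + n % t) % t      ≡⟨ %-distribˡ-+ m n t ⟨
    (m + n) % t              ∎
    where open ≡-Reasoning

  toℕ-addC-addC : ∀ (i j l : Fin t) → toℕ (addC (addC i j) l) ≡ (toℕ i + toℕ j + toℕ l) % t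
  toℕ-addC-addC i j l = begin
    toℕ (addC (addC i j) l)             ≡⟨ toℕ-addC (addC i j) l ⟩
    (toℕ (addC i j) + toℕ l) % t        ≡⟨ cong (λ u → (u + toℕ l) % t) (toℕ-addC i j) ⟩
    ((toℕ i + toℕ j) % t + toℕ l) % t  ≡⟨ [m%t+n]%t≡[m+n]%t (toℕ i + toℕ j) (toℕ l) ⟩
    (toℕ i + toℕ j + toℕ l) % t        ∎
    where open ≡-Reasoning

  addC-comm : Commutative _≡_ (addC {k})
  addC-comm i j = toℕ-injective (begin
    toℕ (addC i j)           ≡⟨ toℕ-addC i j ⟩
    (toℕ i + toℕ j) % t      ≡⟨ cong (_% t) (+-comm (toℕ i) (toℕ j)) ⟩
    (toℕ j + toℕ i) % t      ≡⟨ toℕ-addC j i ⟨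
    toℕ (addC j i)           ∎)
    where open ≡-Reasoning

  addC-assoc : Associative _≡_ (addC {k})
  addC-assoc i j l = toℕ-injective (begin
    toℕ (addC (addC i j) l)        ≡⟨ toℕ-addC-addC i j l ⟩
    (toℕ i + toℕ j + toℕ l) % t    ≡⟨ cong (_% t) (trans (+-assoc (toℕ i) _ _) (+-comm (toℕ i) _)) ⟩
    (toℕ j + toℕ l + toℕ i) % t    ≡⟨ toℕ-addC-addC j l i ⟨
    toℕ (addC (addC j l) i)        ≡⟨ cong toℕ (addC-comm (addC j l) i) ⟩
    toℕ (addC i (addC j l))        ∎)
    where open ≡-Reasoning

  addC-identityˡ : LeftIdentity _≡_ zeroC (addC {k})
  addC-identityˡ i = toℕ-injective (trans (toℕ-addC zeroC i) (m<n⇒m%n≡m (toℕ<n i)))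

  addC-inverseˡ : LeftInverse _≡_ zeroC negC (addC {k})
  addC-inverseˡ i = toℕ-injective (begin
    toℕ (addC (negC i) i)          ≡⟨ toℕ-addC (negC i) i ⟩
    (toℕ (negC i) + toℕ i) % t     ≡⟨ cong (λ u → (u + toℕ i) % t) (toℕ-negC i) ⟩
    ((t ∸ toℕ i) % t + toℕ i) % t  ≡⟨ [m%t+n]%t≡[m+n]%t (t ∸ toℕ i) (toℕ i) ⟩
    (t ∸ toℕ i + toℕ i) % t        ≡⟨ cong (_% t) (m∸n+n≡m (<⇒≤ (toℕ<n i))) ⟩
    t % t                          ≡⟨ n%n≡0 t ⟩
    0                              ∎)
    where open ≡-Reasoning

addC-isAbelianGroup : ∀ k → IsAbelianGroup _≡_ (addC {k}) zeroC negC
addC-isAbelianGroup k = isAbelianGroup addC-assoc addC-comm addC-identityˡ addC-inverseˡ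

⊕-isAbelianGroup : ∀ a b → IsAbelianGroup _≡_ (_⊕_ {a} {b}) 𝟘 ⊖_
⊕-isAbelianGroup a b = isAbelianGroup
  (λ (x , y) (x′ , y′) (x″ , y″) → cong₂ _,_ (C₄ᵃ.assoc x x′ x″) (C₂ᵇ.assoc y y′ y″))
  (λ (x , y) (x′ , y′) → cong₂ _,_ (C₄ᵃ.comm x x′) (C₂ᵇ.comm y y′))
  (λ (x , y) → cong₂ _,_ (C₄ᵃ.identityˡ x) (C₂ᵇ.identityˡ y))
  (λ (x , y) → cong₂ _,_ (C₄ᵃ.inverseˡ x) (C₂ᵇ.inverseˡ y))
  where
    module C₄ᵃ = IsAbelianGroup (zipWith-isAbelianGroup {n = a} (addC-isAbelianGroup 3))
    module C₂ᵇ = IsAbelianGroup (zipWith-isAbelianGroup {n = b} (addC-isAbelianGroup 1))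

G-abelianGroup : ℕ → ℕ → AbelianGroup 0ℓ 0ℓ
G-abelianGroup a b = record { isAbelianGroup = ⊕-isAbelianGroup a b }

module _ {a b : ℕ} where
  open AbelianGroup (G-abelianGroup a b) public
    using () renaming (identityˡ to ⊕-identityˡ; identityʳ to ⊕-identityʳ; inverseʳ to ⊕-inverseʳ)
  open import Algebra.Properties.AbelianGroup (G-abelianGroup a b) public
    using (∙-cancelʳ; identityʳ-unique; inverseʳ-unique; ⁻¹-involutive; ⁻¹-∙-comm; //-rightDividesˡ; //-rightDividesʳ)
  open import Algebra.Properties.CommutativeSemigroup (AbelianGroup.commutativeSemigroup (G-abelianGroup a b))
    using (interchange)

  ⊖-translation-invariant : ∀ (x y c : G a b) → (x ⊕ c) ⊕ (⊖ (y ⊕ c)) ≡ x ⊕ (⊖ y)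
  ⊖-translation-invariant x y c = begin
    (x ⊕ c) ⊕ (⊖ (y ⊕ c))        ≡⟨ cong ((x ⊕ c) ⊕_) (⁻¹-∙-comm y c) ⟨
    (x ⊕ c) ⊕ ((⊖ y) ⊕ (⊖ c))    ≡⟨ interchange x c (⊖ y) (⊖ c) ⟩
    (x ⊕ (⊖ y)) ⊕ (c ⊕ (⊖ c))    ≡⟨ cong ((x ⊕ (⊖ y)) ⊕_) (⊕-inverseʳ c) ⟩
    (x ⊕ (⊖ y)) ⊕ 𝟘              ≡⟨ ⊕-identityʳ (x ⊕ (⊖ y)) ⟩
    x ⊕ (⊖ y)                    ∎
    where open ≡-Reasoning

IsHom : ∀ {a b a′ b′} → (G a′ b′ → G a b) → Set
IsHom φ = ∀ x y → φ (x ⊕ y) ≡ φ x ⊕ φ y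

Ω₁ : ∀ {a b} → G a b → Set
Ω₁ x = x ⊕ x ≡ 𝟘

module _ {a b a′ b′ : ℕ} {φ : G a′ b′ → G a b} (hom : IsHom φ) where

  hom-𝟘 : φ 𝟘 ≡ 𝟘
  hom-𝟘 = identityʳ-unique (φ 𝟘) (φ 𝟘) (trans (sym (hom 𝟘 𝟘)) (cong φ (⊕-identityˡ 𝟘)))

  hom-⊖ : ∀ x → φ (⊖ x) ≡ ⊖ (φ x)
  hom-⊖ x = inverseʳ-unique (φ x) (φ (⊖ x))
    (trans (sym (hom x (⊖ x))) (trans (cong φ (⊕-inverseʳ x)) hom-𝟘))

  hom-Ω₁ : ∀ {x} → Ω₁ x → Ω₁ (φ x)
  hom-Ω₁ {x} Ωx = trans (sym (hom x x)) (trans (cong φ Ωx) hom-𝟘)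

  injective-hom-reflects-Ω₁ : Injective _≡_ _≡_ φ → ∀ {x} → Ω₁ (φ x) → Ω₁ x
  injective-hom-reflects-Ω₁ injective {x} Ωφx = injective (trans (hom x x) (trans Ωφx (sym hom-𝟘)))

module _ {k : ℕ} where

  digits : ∀ n → Fin (k ^ n) → Vec (Fin k) n
  digits zero    _ = []
  digits (suc n) i = quotient {k} (k ^ n) i ∷ digits n (remainder {k} (k ^ n) i)

  fromDigits : ∀ {n} → Vec (Fin k) n → Fin (k ^ n)
  fromDigits []      = fzero
  fromDigits (d ∷ v) = combine d (fromDigits v)

  fromDigits-digits : ∀ n i → fromDigits (digits n i) ≡ i
  fromDigits-digits zero    fzero = refl
  fromDigits-digits (suc n) i =
    trans (cong (combine (quotient {k} (k ^ n) i)) (fromDigits-digits n (remainder {k} (k ^ n) i)))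
          (combine-remQuot {k} (k ^ n) i)

  digits-fromDigits : ∀ {n} (v : Vec (Fin k) n) → digits n (fromDigits v) ≡ v
  digits-fromDigits []      = refl
  digits-fromDigits (d ∷ v) =
    cong₂ _∷_ (cong proj₁ split) (trans (cong (digits _ ∘ proj₂) split) (digits-fromDigits v))
    where split = remQuot-combine d (fromDigits v)

module _ {k a b : ℕ} where

  decode : Fin (k ^ a * 2 ^ b) → Vec (Fin k) a × Vec (Fin 2) b
  decode i = digits a (quotient (2 ^ b) i) , digits b (remainder {k ^ a} (2 ^ b) i)

  encode : Vec (Fin k) a × Vec (Fin 2) b → Fin (k ^ a * 2 ^ b)
  encode (x , y) = combine (fromDigits x) (fromDigits y)

  encode-decode : ∀ i → encode (decode i) ≡ i
  encode-decode i = trans (cong₂ combine (fromDigits-digits a _) (fromDigits-digits b _))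
                          (combine-remQuot {k ^ a} (2 ^ b) i)

  decode-encode : ∀ p → decode (encode p) ≡ p
  decode-encode (x , y) =
    cong₂ _,_ (trans (cong (digits a ∘ proj₁) split) (digits-fromDigits x))
              (trans (cong (digits b ∘ proj₂) split) (digits-fromDigits y))
    where split = remQuot-combine (fromDigits x) (fromDigits y)

  decode-injective : Injective _≡_ _≡_ decode
  decode-injective {i} {j} e = trans (sym (encode-decode i)) (trans (cong encode e) (encode-decode j))

module _ {X : Set} where

  HasCard-≤ : ∀ {_≈_ : X → X → Set} {m n} → IsEquivalence _≈_ → HasCard X _≈_ n →
              (f : Fin m → X) → (∀ {i j} → f i ≈ f j → i ≡ j) → m ≤ n
  HasCard-≤ ≈-isEquivalence (e , _ , onto) f f-injective = injective⇒≤ {f = index ∘ f} λ {i} {j} same →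
    f-injective (≈.trans (≈.sym (proj₂ (onto (f i))))
                         (≈.trans (≈.reflexive (cong e same)) (proj₂ (onto (f j)))))
    where
      module ≈ = IsEquivalence ≈-isEquivalence
      index = λ x → proj₁ (onto x)

  counting⇒¬¬onto : ∀ {P : X → Set} {m n} → n ≤ m →
                    (f : Fin m → X) → Injective _≡_ _≡_ f → (∀ i → P (f i)) →
                    (g : X → Fin n) → (∀ {x y} → P x → P y → g x ≡ g y → x ≡ y) →
                    ∀ {x} → P x → ¬ ¬ ∃ λ i → f i ≡ x
  counting⇒¬¬onto {m = m} n≤m f f-injective Pf g g-injective {x} Px x∉f =
    ≤⇒≯ n≤m (injective⇒≤ h-injective)
    where
      h : Fin (suc m) → Fin _
      h fzero    = g x
      h (fsuc i) = g (f i)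
      h-injective : Injective _≡_ _≡_ h
      h-injective {fzero}  {fzero}  _ = refl
      h-injective {fzero}  {fsuc j} e = ⊥-elim (x∉f (j , sym (g-injective Px (Pf j) e)))
      h-injective {fsuc i} {fzero}  e = ⊥-elim (x∉f (i , g-injective (Pf i) Px e))
      h-injective {fsuc i} {fsuc j} e = cong fsuc (f-injective (g-injective (Pf i) (Pf j) e))

dbl : Fin 2 → Fin 4
dbl 0F = 0F
dbl 1F = 2F

half : Fin 4 → Fin 2
half 0F = 0F
half 1F = 0F
half 2F = 1F
half 3F = 1F

half-dbl : ∀ t → half (dbl t) ≡ t
half-dbl 0F = refl
half-dbl 1F = refl

dbl-half : ∀ x → addC x x ≡ 0F → dbl (half x) ≡ x
dbl-half 0F _  = refl
dbl-half 1F ()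
dbl-half 2F _  = refl
dbl-half 3F ()

double-map-dbl : ∀ {n} (u : Vec (Fin 2) n) → zipWith addC (map dbl u) (map dbl u) ≡ replicate n 0F
double-map-dbl []       = refl
double-map-dbl (0F ∷ u) = cong (0F ∷_) (double-map-dbl u)
double-map-dbl (1F ∷ u) = cong (0F ∷_) (double-map-dbl u)

map-half-dbl : ∀ {n} (u : Vec (Fin 2) n) → map half (map dbl u) ≡ u
map-half-dbl u = trans (sym (map-∘ half dbl u)) (trans (map-cong half-dbl u) (map-id u))

map-dbl-half : ∀ {n} (x : Vec (Fin 4) n) → zipWith addC x x ≡ replicate n 0F → map dbl (map half x) ≡ x
map-dbl-half []      _ = refl
map-dbl-half (d ∷ x) e =
  cong₂ _∷_ (dbl-half d (proj₁ (∷-injective e))) (map-dbl-half x (proj₂ (∷-injective e)))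

double-C₂ : ∀ {n} (y : Vec (Fin 2) n) → zipWith addC y y ≡ replicate n 0F
double-C₂ []       = refl
double-C₂ (0F ∷ y) = cong (0F ∷_) (double-C₂ y)
double-C₂ (1F ∷ y) = cong (0F ∷_) (double-C₂ y)

⊖-C₂ : ∀ {n} (y : Vec (Fin 2) n) → map negC y ≡ y
⊖-C₂ []       = refl
⊖-C₂ (0F ∷ y) = cong (0F ∷_) (⊖-C₂ y)
⊖-C₂ (1F ∷ y) = cong (1F ∷_) (⊖-C₂ y)

module _ {a b : ℕ} where

  Ω₁-intro : (x : Vec (Fin 4) a) (y : Vec (Fin 2) b) → zipWith addC x x ≡ replicate a 0F → Ω₁ (x , y)
  Ω₁-intro x y e = cong₂ _,_ e (double-C₂ y)

  Ω₁-element : Fin (2 ^ a * 2 ^ b) → G a b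
  Ω₁-element i = map dbl (proj₁ (decode {2} {a} {b} i)) , proj₂ (decode {2} {a} {b} i)

  Ω₁-index : G a b → Fin (2 ^ a * 2 ^ b)
  Ω₁-index (x , y) = encode {2} {a} {b} (map half x , y)

  Ω₁-element-Ω₁ : ∀ i → Ω₁ (Ω₁-element i)
  Ω₁-element-Ω₁ i = Ω₁-intro _ _ (double-map-dbl (proj₁ (decode {2} {a} {b} i)))

  Ω₁-element-injective : Injective _≡_ _≡_ Ω₁-element
  Ω₁-element-injective {i} {j} e = decode-injective {2} {a} {b} (cong₂ _,_
    (trans (sym (map-half-dbl _)) (trans (cong (map half ∘ proj₁) e) (map-half-dbl _)))
    (cong proj₂ e))

  Ω₁-element-index : ∀ {x} → Ω₁ x → Ω₁-element (Ω₁-index x) ≡ x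
  Ω₁-element-index {x , y} Ωx =
    trans (cong (λ (u , v) → map dbl u , v) (decode-encode {2} {a} {b} (map half x , y)))
          (cong (_, y) (map-dbl-half x (cong proj₁ Ωx)))

  Ω₁-index-injective : ∀ {x y} → Ω₁ x → Ω₁ y → Ω₁-index x ≡ Ω₁-index y → x ≡ y
  Ω₁-index-injective Ωx Ωy e =
    trans (sym (Ω₁-element-index Ωx)) (trans (cong Ω₁-element e) (Ω₁-element-index Ωy))

module _ {a b a′ b′ : ℕ} where

  Ω₁⊆image : ∀ {φ : G a′ b′ → G a b} → IsHom φ → Injective _≡_ _≡_ φ → a′ + b′ ≡ a + b →
             ∀ {x} → Ω₁ x → ¬ ¬ ∃ λ w → φ w ≡ x
  Ω₁⊆image {φ} hom injective a′+b′≡a+b Ωx =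
    ¬¬-map (λ (i , e) → Ω₁-element i , e)
      (counting⇒¬¬onto (≤-reflexive sizes) (φ ∘ Ω₁-element) (Ω₁-element-injective ∘ injective)
                       (hom-Ω₁ hom ∘ Ω₁-element-Ω₁) Ω₁-index Ω₁-index-injective Ωx)
    where
      sizes : 2 ^ a * 2 ^ b ≡ 2 ^ a′ * 2 ^ b′
      sizes = trans (sym (^-distribˡ-+-* 2 a b))
                    (trans (cong (2 ^_) (sym a′+b′≡a+b)) (^-distribˡ-+-* 2 a′ b′))

  Ω₁⊆B : ∀ {B : G a b → Set} → IsoTo B a′ b′ → a′ + b′ ≡ a + b → ∀ {x} → Ω₁ x → ¬ ¬ B x
  Ω₁⊆B (φ , hom , injective , image) a′+b′≡a+b {x} Ωx =
    ¬¬-map (proj₂ (image x)) (Ω₁⊆image hom (injective _ _) a′+b′≡a+b Ωx)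

record Involution {a b} (S : G a b → Bool) : Set where
  field
    σ          : G a b → G a b
    hom        : IsHom σ
    involutive : ∀ x → σ (σ x) ≡ x
    preserves  : ∀ x → S x ≡ true → S (σ x) ≡ true

open Involution using (σ)

module _ {a b : ℕ} {S : G a b → Bool} where

  affine : Involution S → G a b → CayAut S
  affine ρ c = record
    { fun       = λ x → σ ρ x ⊕ c
    ; inv       = λ x → σ ρ (x ⊕ (⊖ c))
    ; inv-left  = λ x → trans (cong (σ ρ) (//-rightDividesʳ c (σ ρ x))) (involutive x)
    ; inv-right = λ x → trans (cong (_⊕ c) (involutive (x ⊕ (⊖ c)))) (//-rightDividesˡ c x)
    ; pres      = λ g h →
        (λ arc → subst (λ w → S w ≡ true) (sym (difference g h)) (preserves _ arc)) ,
        (λ arc → subst (λ w → S w ≡ true) (involutive (g ⊕ (⊖ h)))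
                   (preserves _ (subst (λ w → S w ≡ true) (difference g h) arc)))
    }
    where
      open Involution ρ using (hom; involutive; preserves)
      difference : ∀ g h → (σ ρ g ⊕ c) ⊕ (⊖ (σ ρ h ⊕ c)) ≡ σ ρ (g ⊕ (⊖ h))
      difference g h = trans (⊖-translation-invariant (σ ρ g) (σ ρ h) c)
                             (trans (cong (σ ρ g ⊕_) (sym (hom-⊖ hom h))) (sym (hom g (⊖ h))))

  affine-injective : ∀ ρ ρ′ c c′ → affine ρ c ≈Aut affine ρ′ c′ → c ≡ c′ × (∀ x → σ ρ x ≡ σ ρ′ x)
  affine-injective ρ ρ′ c c′ same =
    c≡c′ , λ x → ∙-cancelʳ c (σ ρ x) (σ ρ′ x) (trans (same x) (cong (σ ρ′ x ⊕_) (sym c≡c′)))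
    where
      c≡c′ : c ≡ c′
      c≡c′ = begin
        c             ≡⟨ ⊕-identityˡ c ⟨
        𝟘 ⊕ c         ≡⟨ cong (_⊕ c) (hom-𝟘 (Involution.hom ρ)) ⟨
        σ ρ 𝟘 ⊕ c     ≡⟨ same 𝟘 ⟩
        σ ρ′ 𝟘 ⊕ c′   ≡⟨ cong (_⊕ c′) (hom-𝟘 (Involution.hom ρ′)) ⟩
        𝟘 ⊕ c′        ≡⟨ ⊕-identityˡ c′ ⟩
        c′            ∎
        where open ≡-Reasoning

  ≈Aut-isEquivalence : IsEquivalence (_≈Aut_ {S = S})
  ≈Aut-isEquivalence = record
    { refl = λ _ → refl ; sym = λ e x → sym (e x) ; trans = λ e f x → trans (e x) (f x) }

  affine-family-≤ : ∀ {k n} → HasCard (CayAut S) _≈Aut_ n → (ρ : Fin k → Involution S) →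
                    (∀ {i j} → (∀ x → σ (ρ i) x ≡ σ (ρ j) x) → i ≡ j) → k * order a b ≤ n
  affine-family-≤ {k} card ρ ρ-distinct = HasCard-≤ ≈Aut-isEquivalence card aut aut-injective
    where
      involution : Fin (k * order a b) → Involution S
      involution i = ρ (quotient (order a b) i)
      aut : Fin (k * order a b) → CayAut S
      aut i = affine (involution i) (decode {4} {a} {b} (remainder {k} (order a b) i))
      aut-injective : ∀ {i j} → aut i ≈Aut aut j → i ≡ j
      aut-injective {i} {j} same =
        trans (sym (combine-remQuot {k} (order a b) i))
              (trans (cong₂ combine (ρ-distinct σ≗σ′) (decode-injective {4} {a} {b} c≡c′))
                     (combine-remQuot {k} (order a b) j))
        where
          c≡c′ = proj₁ (affine-injective (involution i) (involution j) _ _ same)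
          σ≗σ′ = proj₂ (affine-injective (involution i) (involution j) _ _ same)

  id-involution : Involution S
  id-involution = record
    { σ = λ x → x ; hom = λ _ _ → refl ; involutive = λ _ → refl ; preserves = λ _ Sx → Sx }

  ⊖-involution : InverseClosed S → Involution S
  ⊖-involution inverseClosed = record
    { σ = ⊖_ ; hom = λ x y → sym (⁻¹-∙-comm x y) ; involutive = ⁻¹-involutive ; preserves = inverseClosed }

  ±-involution : InverseClosed S → (σ : G a b → G a b) → IsHom σ → (∀ x → σ (σ x) ≡ x) →
                 (∀ p → S p ≡ true → σ p ≡ p ⊎ σ p ≡ ⊖ p) → Involution S
  ±-involution inverseClosed σ hom involutive ± = record
    { σ = σ ; hom = hom ; involutive = involutive ; preserves = preserves }
    where
      preserves : ∀ p → S p ≡ true → S (σ p) ≡ true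
      preserves p Sp with ± p Sp
      ... | inj₁ σp≡p  = subst (λ w → S w ≡ true) (sym σp≡p) Sp
      ... | inj₂ σp≡⊖p = subst (λ w → S w ≡ true) (sym σp≡⊖p) (inverseClosed p Sp)

_∉±_ : ∀ {a b} → G a b → G a b → Set
u ∉± w = u ≢ w × u ≢ ⊖ w

module _ {a b : ℕ} {S : G (suc a) b → Bool} (inverseClosed : InverseClosed S) where

  ¬AutIndex2 : (ρ : Involution S) → (∃ λ w → σ ρ w ∉± w) → ¬ AutIndex2 S
  ¬AutIndex2 ρ (w , σw≢w , σw≢⊖w) card =
    3≰2 (*-cancelʳ-≤ 3 2 (order (suc a) b) {{order≢0}} 3N≤2N)
    where
      order≢0 = m*n≢0 (4 ^ suc a) (2 ^ b) {{m^n≢0 4 (suc a)}} {{m^n≢0 2 b}}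
      3≰2 : ¬ 3 ≤ 2
      3≰2 (s≤s (s≤s ()))
      family : Fin 3 → Involution S
      family 0F = id-involution
      family 1F = ⊖-involution inverseClosed
      family 2F = ρ
      e₁ : G (suc a) b
      e₁ = (1F ∷ replicate a 0F) , replicate b 0F
      ⊖e₁≢e₁ : ⊖ e₁ ≢ e₁
      ⊖e₁≢e₁ ()
      distinct : ∀ {i j} → (∀ x → σ (family i) x ≡ σ (family j) x) → i ≡ j
      distinct {0F} {0F} _ = refl
      distinct {0F} {1F} e = ⊥-elim (⊖e₁≢e₁ (sym (e e₁)))
      distinct {0F} {2F} e = ⊥-elim (σw≢w (sym (e w)))
      distinct {1F} {0F} e = ⊥-elim (⊖e₁≢e₁ (e e₁))
      distinct {1F} {1F} _ = refl
      distinct {1F} {2F} e = ⊥-elim (σw≢⊖w (sym (e w)))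
      distinct {2F} {0F} e = ⊥-elim (σw≢w (e w))
      distinct {2F} {1F} e = ⊥-elim (σw≢⊖w (e w))
      distinct {2F} {2F} _ = refl
      3N≤2N : 3 * order (suc a) b ≤ 2 * order (suc a) b
      3N≤2N = affine-family-≤ card family distinct

parity : Fin 4 → Fin 2
parity 0F = 0F
parity 1F = 1F
parity 2F = 0F
parity 3F = 1F

-- On x of order 4, 2y − x is x when y = 1 and −x when y = 0.
reflect₁ : Fin 4 → Fin 2 → Fin 4
reflect₁ x y = addC (dbl y) (negC x)

-- The arguments are the parities r of the C₄-coordinates of z; r ≠ 0 as z has order 4.  S lies in the two parity classes other than 0 and r, and the map fixes one
-- of them and negates the other.
reflect₂ : Fin 2 → Fin 2 → Vec (Fin 4) 2 → Vec (Fin 4) 2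
reflect₂ 1F 0F (x₁ ∷ x₂ ∷ []) = x₁ ∷ addC (addC x₁ x₁) (negC x₂) ∷ []
reflect₂ 0F 1F (x₁ ∷ x₂ ∷ []) = addC (addC x₂ x₂) (negC x₁) ∷ x₂ ∷ []
reflect₂ 1F 1F (x₁ ∷ x₂ ∷ []) = negC x₁ ∷ x₂ ∷ []
reflect₂ 0F 0F x              = x

by-exhaustion : {A : Set} (d : Dec A) {_ : True d} → A
by-exhaustion _ {found} = toWitness found

_≟ᵛ_ : (x y : Vec (Fin 4) 2) → Dec (x ≡ y)
_≟ᵛ_ = ≡-decVec _≟_

-- Opaque: otherwise the with-abstractions over these facts below unfold the exhaustive checks,
-- which makes type checking very slow.
opaque
  reflect₁-hom : ∀ x y x′ y′ → reflect₁ (addC x x′) (addC y y′) ≡ addC (reflect₁ x y) (reflect₁ x′ y′)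
  reflect₁-hom = by-exhaustion (all? λ _ → all? λ _ → all? λ _ → all? λ _ → _ ≟ _)

  reflect₁-involutive : ∀ x y → reflect₁ (reflect₁ x y) y ≡ x
  reflect₁-involutive = by-exhaustion (all? λ _ → all? λ _ → _ ≟ _)

  reflect₁-± : ∀ x y → addC x x ≡ 0F ⊎ reflect₁ x y ≡ x ⊎ reflect₁ x y ≡ negC x
  reflect₁-± = by-exhaustion (all? λ _ → all? λ _ → (_ ≟ _) ⊎-dec (_ ≟ _) ⊎-dec (_ ≟ _))

  reflect₂-hom : ∀ r₁ r₂ x₁ x₂ x₁′ x₂′ →
    reflect₂ r₁ r₂ (addC x₁ x₁′ ∷ addC x₂ x₂′ ∷ []) ≡
    zipWith addC (reflect₂ r₁ r₂ (x₁ ∷ x₂ ∷ [])) (reflect₂ r₁ r₂ (x₁′ ∷ x₂′ ∷ []))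
  reflect₂-hom = by-exhaustion
    (all? λ _ → all? λ _ → all? λ _ → all? λ _ → all? λ _ → all? λ _ → _ ≟ᵛ _)

  reflect₂-involutive : ∀ r₁ r₂ x₁ x₂ → reflect₂ r₁ r₂ (reflect₂ r₁ r₂ (x₁ ∷ x₂ ∷ [])) ≡ x₁ ∷ x₂ ∷ []
  reflect₂-involutive = by-exhaustion (all? λ _ → all? λ _ → all? λ _ → all? λ _ → _ ≟ᵛ _)

  reflect₂-± : ∀ z₁ z₂ x₁ x₂ →
    let z = z₁ ∷ z₂ ∷ [] ; x = x₁ ∷ x₂ ∷ [] ; d = zipWith addC x (map negC z)
        σx = reflect₂ (parity z₁) (parity z₂) x
    in zipWith addC x x ≡ replicate 2 0F ⊎ zipWith addC d d ≡ replicate 2 0F ⊎ σx ≡ x ⊎ σx ≡ map negC x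
  reflect₂-± = by-exhaustion (all? λ _ → all? λ _ → all? λ _ → all? λ _ →
    (_ ≟ᵛ _) ⊎-dec (_ ≟ᵛ _) ⊎-dec (_ ≟ᵛ _) ⊎-dec (_ ≟ᵛ _))

  reflect₂-moves : ∀ z₁ z₂ →
    let z = z₁ ∷ z₂ ∷ [] ; σz = reflect₂ (parity z₁) (parity z₂) z
    in zipWith addC z z ≡ replicate 2 0F ⊎ (σz ≢ z × σz ≢ map negC z)
  reflect₂-moves = by-exhaustion (all? λ _ → all? λ _ →
    (_ ≟ᵛ _) ⊎-dec (¬? (_ ≟ᵛ _) ×-dec ¬? (_ ≟ᵛ _)))

module _ {n : ℕ} where

  reflection₁ : G 1 (suc n) → G 1 (suc n)
  reflection₁ ((x ∷ []) , (y ∷ ys)) = (reflect₁ x y ∷ []) , (y ∷ ys)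

  reflection₁-hom : IsHom reflection₁
  reflection₁-hom ((x ∷ []) , (y ∷ _)) ((x′ ∷ []) , (y′ ∷ _)) =
    cong (λ t → (t ∷ []) , _) (reflect₁-hom x y x′ y′)

  reflection₁-involutive : ∀ p → reflection₁ (reflection₁ p) ≡ p
  reflection₁-involutive ((x ∷ []) , (y ∷ _)) = cong (λ t → (t ∷ []) , _) (reflect₁-involutive x y)

  reflection₁-± : ∀ p → ¬ Ω₁ p → reflection₁ p ≡ p ⊎ reflection₁ p ≡ ⊖ p
  reflection₁-± ((x ∷ []) , (y ∷ ys)) ¬Ωp with reflect₁-± x y
  ... | inj₁ Ωx         = ⊥-elim (¬Ωp (Ω₁-intro (x ∷ []) (y ∷ ys) (cong (_∷ []) Ωx)))
  ... | inj₂ (inj₁ fix) = inj₁ (cong (λ t → (t ∷ []) , (y ∷ ys)) fix)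
  ... | inj₂ (inj₂ neg) = inj₂ (cong₂ _,_ (cong (_∷ []) neg) (sym (⊖-C₂ (y ∷ ys))))

  reflection₁-moves : ∃ λ w → reflection₁ w ∉± w
  reflection₁-moves = ((0F ∷ []) , (1F ∷ replicate n 0F)) , (λ ()) , (λ ())

  reflection₂ : G 2 n → G 2 n → G 2 n
  reflection₂ ((z₁ ∷ z₂ ∷ []) , _) (x , ys) = reflect₂ (parity z₁) (parity z₂) x , ys

  reflection₂-hom : ∀ z → IsHom (reflection₂ z)
  reflection₂-hom ((z₁ ∷ z₂ ∷ []) , _) ((x₁ ∷ x₂ ∷ []) , _) ((x₁′ ∷ x₂′ ∷ []) , _) =
    cong (_, _) (reflect₂-hom (parity z₁) (parity z₂) x₁ x₂ x₁′ x₂′)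

  reflection₂-involutive : ∀ z p → reflection₂ z (reflection₂ z p) ≡ p
  reflection₂-involutive ((z₁ ∷ z₂ ∷ []) , _) ((x₁ ∷ x₂ ∷ []) , _) =
    cong (_, _) (reflect₂-involutive (parity z₁) (parity z₂) x₁ x₂)

  reflection₂-± : ∀ z p → ¬ Ω₁ p → ¬ Ω₁ (p ⊕ (⊖ z)) → reflection₂ z p ≡ p ⊎ reflection₂ z p ≡ ⊖ p
  reflection₂-± ((z₁ ∷ z₂ ∷ []) , _) ((x₁ ∷ x₂ ∷ []) , ys) ¬Ωp ¬Ωd with reflect₂-± z₁ z₂ x₁ x₂
  ... | inj₁ Ωx                = ⊥-elim (¬Ωp (Ω₁-intro (x₁ ∷ x₂ ∷ []) ys Ωx))
  ... | inj₂ (inj₁ Ωd)         =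
    ⊥-elim (¬Ωd (Ω₁-intro (zipWith addC (x₁ ∷ x₂ ∷ []) (map negC (z₁ ∷ z₂ ∷ []))) _ Ωd))
  ... | inj₂ (inj₂ (inj₁ fix)) = inj₁ (cong (_, ys) fix)
  ... | inj₂ (inj₂ (inj₂ neg)) = inj₂ (cong₂ _,_ neg (sym (⊖-C₂ ys)))

  reflection₂-moves : ∀ z → ¬ Ω₁ z → reflection₂ z z ∉± z
  reflection₂-moves ((z₁ ∷ z₂ ∷ []) , zs) ¬Ωz with reflect₂-moves z₁ z₂
  ... | inj₁ Ωz         = ⊥-elim (¬Ωz (Ω₁-intro (z₁ ∷ z₂ ∷ []) zs Ωz))
  ... | inj₂ (≢z , ≢⊖z) = (λ e → ≢z (cong proj₁ e)) , (λ e → ≢⊖z (cong proj₁ e))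

theorem1p8 : ∀ {a b a' b' : ℕ} → Case a b a' b' →
    (B : G a b → Set) → IsSubgroup B → Index2 B → IsoTo B a' b' →
    ¬ (Σ (G a b → Bool) λ S → InverseClosed S × OutsideOf S B × AutIndex2 S)
theorem1p8 (case1 zero ())
theorem1p8 (case1 (suc ℓ) _) B _ _ iso (S , inverseClosed , outside , card) =
  ¬AutIndex2 inverseClosed
    (±-involution inverseClosed reflection₁ reflection₁-hom reflection₁-involutive
       (λ p Sp → reflection₁-± p (S∩Ω₁=∅ p Sp)))
    reflection₁-moves card
  where
    S∩Ω₁=∅ : ∀ p → S p ≡ true → ¬ Ω₁ p
    S∩Ω₁=∅ p Sp Ωp = Ω₁⊆B iso refl Ωp (outside p Sp)
theorem1p8 (case2 ℓ) B subgroup _ iso@(φ , hom , injective , image) (S , inverseClosed , outside , card) =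
  ¬AutIndex2 inverseClosed
    (±-involution inverseClosed (reflection₂ z) (reflection₂-hom z) (reflection₂-involutive z)
       (λ p Sp → reflection₂-± z p (S∩Ω₁=∅ p Sp) (S∩[z+Ω₁]=∅ p Sp)))
    (z , reflection₂-moves z ¬Ωz) card
  where
    open IsSubgroup subgroup
    e₁ : G 1 (suc ℓ)
    e₁ = (1F ∷ []) , replicate (suc ℓ) 0F
    z : G 2 ℓ
    z = φ e₁
    z∈B : B z
    z∈B = proj₂ (image z) (e₁ , refl)
    ¬Ωz : ¬ Ω₁ z
    ¬Ωz Ωz with injective-hom-reflects-Ω₁ hom (injective _ _) Ωz
    ... | ()
    S∩Ω₁=∅ : ∀ p → S p ≡ true → ¬ Ω₁ p
    S∩Ω₁=∅ p Sp Ωp = Ω₁⊆B iso refl Ωp (outside p Sp)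
    S∩[z+Ω₁]=∅ : ∀ p → S p ≡ true → ¬ Ω₁ (p ⊕ (⊖ z))
    S∩[z+Ω₁]=∅ p Sp Ωd = Ω₁⊆B iso refl Ωd λ d∈B →
      outside p Sp (subst B (//-rightDividesˡ z p) (closed-⊕ _ _ d∈B z∈B))
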